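{- Let $p$ be an odd prime and let $v\in\mathbb{F}_2^p$ be a nonzero small vector with $v_0=0$ that works together with $\bar e$, and let $k$ be the girth of $G_v$. Suppose $C$ is (the vertex set of) a directed cycle of length $k$ in $G_v$. Then for every $i\in\mathbb{Z}/p\mathbb{Z}$ with $i\notin C$, there are at least two edges (ignoring direction) between $i$ and $C$.
   Context: Indices are mod $p$; $\sigma$ is the cyclic shift $(\sigma x)_{i+1}=x_i$. Vectors $v,w\in\mathbb{F}_2^p$ work together if for every $x\in\mathbb{F}_2^p$ there is $k$ with $v\cdot\sigma^kx=w\cdot\sigma^kx=0$. $\bar e\in\mathbb{F}_2^p$ has $\bar e_0=0$, $\bar e_i=1$ for $i\ne0$. A vector $v$ is small if there is no $i$ with $v_i=v_{ -i}=1$. $G_v$ is the Cayley digraph on $\mathbb{Z}/p\mathbb{Z}$ with an arc from $i$ to $i+j$ exactly when $v_j=1$; its girth is the length of its shortest directed cycle. -}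

module Defs where

open import Data.Nat using (ℕ; zero; suc; _+_; _∸_; _%_; _≡ᵇ_)
open import Data.Nat.DivMod using (m%n<n)
open import Data.Bool using (Bool; true; false; not; _∧_; _xor_; if_then_else_)
open import Data.Fin using (Fin; toℕ; fromℕ<)
open import Data.List using (List; foldr; map; allFin; length; filter)
open import Data.Product using (Σ; ∃; ∃-syntax; _×_; _,_)
open import Relation.Binary.PropositionalEquality using (_≡_)
open import Relation.Nullary using (¬_)
open import Function.Base using (_∘_)
open import Function.Definitions using (Injective)

-- Z/pZ is represented by Fin p; arithmetic is mod p.
_⊕_ : ∀ {p} → Fin p → Fin p → Fin p
_⊕_ {suc n} i j = fromℕ< (m%n<n (toℕ i + toℕ j) (suc n))

⊖_ : ∀ {p} → Fin p → Fin p
⊖_ {suc n} i = fromℕ< (m%n<n (suc n ∸ toℕ i) (suc n))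

_⊝_ : ∀ {p} → Fin p → Fin p → Fin p
i ⊝ j = i ⊕ (⊖ j)

one : ∀ {p} → Fin p → Fin p
one {suc n} _ = fromℕ< (m%n<n 1 (suc n))

-- Vectors in F_2^p (F_2 = Bool with xor as +, ∧ as ·)
BV : ℕ → Set
BV p = Fin p → Bool

_·_ : ∀ {p} → BV p → BV p → Bool
_·_ {p} v x = foldr _xor_ false (map (λ i → v i ∧ x i) (allFin p))

-- cyclic shift: (σ x)_{i+1} = x_i, i.e. (σ x)_j = x_{j-1}
σ : ∀ {p} → BV p → BV p
σ x j = x (j ⊝ one j)

σ^ : ∀ {p} → ℕ → BV p → BV p
σ^ zero x = x
σ^ (suc k) x = σ (σ^ k x)

WorkTogether : ∀ {p} → BV p → BV p → Set
WorkTogether {p} v w =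
  ∀ (x : BV p) → ∃[ k ] ((v · σ^ k x) ≡ false × (w · σ^ k x) ≡ false)

ē : ∀ {p} → BV p
ē i = not (toℕ i ≡ᵇ 0)

Small : ∀ {p} → BV p → Set
Small {p} v = ¬ (∃[ i ] (v i ≡ true × v (⊖ i) ≡ true))

Nonzero : ∀ {p} → BV p → Set
Nonzero {p} v = ∃[ i ] (v i ≡ true)

-- G_v: arc i → i + j iff v_j = 1, i.e. arc i → j iff v_{j-i} = 1
Arc : ∀ {p} → BV p → Fin p → Fin p → Set
Arc v i j = v (j ⊝ i) ≡ true

arcᵇ : ∀ {p} → BV p → Fin p → Fin p → Bool
arcᵇ v i j = v (j ⊝ i)

next : ∀ {L} → Fin L → Fin L
next {suc m} t = fromℕ< (m%n<n (suc (toℕ t)) (suc m))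

IsDirCycle : ∀ {p} → BV p → (L : ℕ) → (Fin L → Fin p) → Set
IsDirCycle v L c = ¬ (L ≡ 0) × Injective _≡_ _≡_ c × (∀ t → Arc v (c t) (c (next t)))

IsGirth : ∀ {p} → BV p → ℕ → Set
IsGirth {p} v k =
  (∃[ c ] IsDirCycle v k c) ×
  (∀ (L : ℕ) (c : Fin L → Fin p) → IsDirCycle v L c → k Data.Nat.≤ L)

_∈C_ : ∀ {p L} → Fin p → (Fin L → Fin p) → Set
i ∈C c = ∃[ t ] (c t ≡ i)

edgesBetween : ∀ {p L} → BV p → Fin p → (Fin L → Fin p) → ℕ
edgesBetween {p} {L} v i c =
  length (filter (λ t → Data.Bool._≟_ (arcᵇ v i (c t)) true) (allFin L))
  + length (filter (λ t → Data.Bool._≟_ (arcᵇ v (c t) i) true) (allFin L))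

module Submission where

open import Defs
open import Data.Nat using (ℕ; _≤_)
open import Data.Nat.Primality using (Prime)
open import Data.Fin using (Fin; toℕ)
open import Data.Bool using (false)
open import Relation.Binary.PropositionalEquality using (_≡_; _≢_)
open import Relation.Nullary using (¬_)

open import Data.Nat using (zero; suc; _+_; _*_; _∸_; _%_; _<_; _≤?_; s≤s; z≤n; NonZero; ≢-nonZero)
open import Data.Nat.DivMod using (m%n<n; %-distribˡ-+; m<n⇒m%n≡m; n%n≡0; m*n%n≡0)
import Data.Nat.Properties as ℕ
open import Data.Nat.Coprimality using (prime⇒coprime; coprime-Bézout)
open import Data.Nat.GCD using (module Bézout)
open import Data.Bool using (Bool; true; not; _∧_; _xor_; if_then_else_)
import Data.Bool as Bool
open import Data.Bool.Properties
  using (xor-∧-commutativeRing; xor-identityʳ; ∧-comm; ∧-identityʳ; ∧-distribʳ-xor; ¬-not)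
open import Data.Fin using (fromℕ<; _≟_; punchIn) renaming (zero to fzero; suc to fsuc)
open import Data.Fin.Properties using (toℕ-injective; toℕ-fromℕ<; toℕ<n; punchInᵢ≢i)
open import Data.Fin.Permutation using (permutation)
open import Data.List using (length; filter; tabulate; allFin; foldr)
open import Data.List.Properties using (filter-some; map-tabulate)
open import Data.List.Membership.Propositional using (lose)
open import Data.List.Membership.Propositional.Properties using (∈-allFin)
open import Data.Product using (∃-syntax; _×_; _,_; proj₁; proj₂)
open import Data.Sum using (_⊎_; inj₁; inj₂)
open import Data.Empty using (⊥; ⊥-elim)
open import Function.Base using (_∘_; id)
open import Relation.Nullary using (does; yes; no)
open import Relation.Nullary.Decidable using (dec-true; dec-false)
open import Relation.Binary.Definitions using (tri<; tri≈; tri>)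
open import Relation.Binary.PropositionalEquality
  using (refl; sym; trans; cong; cong₂; subst; subst₂; isEquivalence; module ≡-Reasoning)
open import Algebra.Bundles using (AbelianGroup; CommutativeRing)
open import Algebra.Structures using (IsAbelianGroup)
import Algebra.Properties.AbelianGroup

open import Algebra.Properties.Semiring.Sum (CommutativeRing.semiring xor-∧-commutativeRing)
  using (sum; sum-cong-≗; ∑-distrib-+; sum-replicate-zero; sum-remove; sum-permute; ∑-comm; *-distribʳ-sum)

-- Write p = n + 1, K = k + 1 for the girth, and call a
-- vertex a isolated from the cycle C if there is no arc between a and C.
-- 1. Z/pZ (on Fin p with the operations of Defs) is an abelian group.
-- 2. Working together with ē says: every x has a translate orthogonal to v
--    and to ē.  In terms of a set X of vertices this is a parity lemma: if
--    |X| is odd, some u ∈ X has an even number of out-neighbours in X (and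
--    likewise some u ∈ X has an even number of in-neighbours in X).
-- 3. By minimality every chord of a shortest cycle is one of its arcs, so
--    every vertex of it has in- and out-degree 1 on it.  The parity lemma
--    applied to the cycle shows that K is even, and applied to the cycle plus
--    one vertex a, that a cannot have exactly one edge to the cycle.
-- 4. Swapping two consecutive steps of a shortest cycle gives a shortest
--    cycle, and (by 3 and smallness of v) preserves isolation of a vertex.
--    Bubbling the first step w = C 1 - C 0 around the cycle shows that the
--    vertices isolated from C are closed under adding w; as p is prime and
--    w ≠ 0 this reaches C 0, which is not isolated.  So no vertex is isolated.

module ZMod (n : ℕ) where
  open ≡-Reasoning

  ⟦_⟧ : ℕ → Fin (suc n)
  ⟦ m ⟧ = fromℕ< (m%n<n m (suc n))

  toℕ-⟦⟧ : ∀ m → toℕ ⟦ m ⟧ ≡ m % suc n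
  toℕ-⟦⟧ m = toℕ-fromℕ< (m%n<n m (suc n))

  ⟦⟧-≡-% : ∀ a b → a % suc n ≡ b % suc n → ⟦ a ⟧ ≡ ⟦ b ⟧
  ⟦⟧-≡-% a b e = toℕ-injective (trans (toℕ-⟦⟧ a) (trans e (sym (toℕ-⟦⟧ b))))

  ⟦toℕ⟧ : ∀ i → ⟦ toℕ i ⟧ ≡ i
  ⟦toℕ⟧ i = toℕ-injective (trans (toℕ-⟦⟧ (toℕ i)) (m<n⇒m%n≡m (toℕ<n i)))

  toℕ-⟦⟧-< : ∀ {m} → m < suc n → toℕ ⟦ m ⟧ ≡ m
  toℕ-⟦⟧-< {m} m<p = trans (toℕ-⟦⟧ m) (m<n⇒m%n≡m m<p)

  ⟦0⟧ : ⟦ 0 ⟧ ≡ fzero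
  ⟦0⟧ = toℕ-injective (toℕ-⟦⟧ 0)

  ⟦p⟧ : ⟦ suc n ⟧ ≡ fzero
  ⟦p⟧ = trans (⟦⟧-≡-% (suc n) 0 (n%n≡0 (suc n))) ⟦0⟧

  ⟦⟧-+ : ∀ a b → ⟦ a ⟧ ⊕ ⟦ b ⟧ ≡ ⟦ a + b ⟧
  ⟦⟧-+ a b = ⟦⟧-≡-% (toℕ ⟦ a ⟧ + toℕ ⟦ b ⟧) (a + b) (begin
    (toℕ ⟦ a ⟧ + toℕ ⟦ b ⟧) % suc n   ≡⟨ cong₂ (λ x y → (x + y) % suc n) (toℕ-⟦⟧ a) (toℕ-⟦⟧ b) ⟩
    (a % suc n + b % suc n) % suc n   ≡⟨ %-distribˡ-+ a b (suc n) ⟨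
    (a + b) % suc n                   ∎)

  ⊕-comm : ∀ (i j : Fin (suc n)) → i ⊕ j ≡ j ⊕ i
  ⊕-comm i j = cong ⟦_⟧ (ℕ.+-comm (toℕ i) (toℕ j))

  ⊕-assoc : ∀ (i j k : Fin (suc n)) → (i ⊕ j) ⊕ k ≡ i ⊕ (j ⊕ k)
  ⊕-assoc i j k = begin
    (i ⊕ j) ⊕ k                         ≡⟨ cong ((i ⊕ j) ⊕_) (⟦toℕ⟧ k) ⟨
    ⟦ toℕ i + toℕ j ⟧ ⊕ ⟦ toℕ k ⟧       ≡⟨ ⟦⟧-+ (toℕ i + toℕ j) (toℕ k) ⟩
    ⟦ toℕ i + toℕ j + toℕ k ⟧           ≡⟨ cong ⟦_⟧ (ℕ.+-assoc (toℕ i) (toℕ j) (toℕ k)) ⟩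
    ⟦ toℕ i + (toℕ j + toℕ k) ⟧         ≡⟨ ⟦⟧-+ (toℕ i) (toℕ j + toℕ k) ⟨
    ⟦ toℕ i ⟧ ⊕ ⟦ toℕ j + toℕ k ⟧       ≡⟨ cong (_⊕ (j ⊕ k)) (⟦toℕ⟧ i) ⟩
    i ⊕ (j ⊕ k)                         ∎

  ⊕-identityʳ : ∀ (i : Fin (suc n)) → i ⊕ fzero ≡ i
  ⊕-identityʳ i = trans (cong ⟦_⟧ (ℕ.+-identityʳ (toℕ i))) (⟦toℕ⟧ i)

  ⊖-inverseʳ : ∀ (i : Fin (suc n)) → i ⊕ (⊖ i) ≡ fzero
  ⊖-inverseʳ i = begin
    i ⊕ (⊖ i)                           ≡⟨ cong (_⊕ (⊖ i)) (⟦toℕ⟧ i) ⟨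
    ⟦ toℕ i ⟧ ⊕ ⟦ suc n ∸ toℕ i ⟧       ≡⟨ ⟦⟧-+ (toℕ i) (suc n ∸ toℕ i) ⟩
    ⟦ toℕ i + (suc n ∸ toℕ i) ⟧         ≡⟨ cong ⟦_⟧ (ℕ.m+[n∸m]≡n (ℕ.<⇒≤ (toℕ<n i))) ⟩
    ⟦ suc n ⟧                           ≡⟨ ⟦p⟧ ⟩
    fzero                               ∎

  ⊕-identityˡ : ∀ (i : Fin (suc n)) → fzero ⊕ i ≡ i
  ⊕-identityˡ i = trans (⊕-comm fzero i) (⊕-identityʳ i)

  ⊖-inverseˡ : ∀ (i : Fin (suc n)) → (⊖ i) ⊕ i ≡ fzero
  ⊖-inverseˡ i = trans (⊕-comm (⊖ i) i) (⊖-inverseʳ i)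

  isAbelianGroup : IsAbelianGroup _≡_ _⊕_ fzero ⊖_
  isAbelianGroup = record
    { isGroup = record
      { isMonoid = record
        { isSemigroup = record
          { isMagma = record { isEquivalence = isEquivalence ; ∙-cong = cong₂ _⊕_ }
          ; assoc = ⊕-assoc }
        ; identity = ⊕-identityˡ , ⊕-identityʳ }
      ; inverse = ⊖-inverseˡ , ⊖-inverseʳ
      ; ⁻¹-cong = cong ⊖_ }
    ; comm = ⊕-comm }

  group : AbelianGroup _ _
  group = record { isAbelianGroup = isAbelianGroup }

  open Algebra.Properties.AbelianGroup group public

  next≡⊕1 : ∀ (t : Fin (suc n)) → next t ≡ t ⊕ ⟦ 1 ⟧
  next≡⊕1 t = begin
    ⟦ suc (toℕ t) ⟧         ≡⟨ cong ⟦_⟧ (ℕ.+-comm 1 (toℕ t)) ⟩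
    ⟦ toℕ t + 1 ⟧           ≡⟨ ⟦⟧-+ (toℕ t) 1 ⟨
    ⟦ toℕ t ⟧ ⊕ ⟦ 1 ⟧       ≡⟨ cong (_⊕ ⟦ 1 ⟧) (⟦toℕ⟧ t) ⟩
    t ⊕ ⟦ 1 ⟧               ∎

  next-⊕ : ∀ (a b : Fin (suc n)) → next (a ⊕ b) ≡ a ⊕ next b
  next-⊕ a b = trans (next≡⊕1 (a ⊕ b)) (trans (⊕-assoc a b ⟦ 1 ⟧) (cong (a ⊕_) (sym (next≡⊕1 b))))

  next-⟦⟧ : ∀ m → next ⟦ m ⟧ ≡ ⟦ suc m ⟧
  next-⟦⟧ m = trans (next≡⊕1 ⟦ m ⟧) (trans (⟦⟧-+ m 1) (cong ⟦_⟧ (ℕ.+-comm m 1)))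

  next-last : ∀ (t : Fin (suc n)) → toℕ t ≡ n → next t ≡ fzero
  next-last t t≡n = trans (cong (λ m → ⟦ suc m ⟧) t≡n) ⟦p⟧

  prev : Fin (suc n) → Fin (suc n)
  prev t = t ⊝ ⟦ 1 ⟧

  next-prev : ∀ t → next (prev t) ≡ t
  next-prev t = trans (next≡⊕1 (prev t)) (//-rightDividesˡ ⟦ 1 ⟧ t)

  prev-next : ∀ t → prev (next t) ≡ t
  prev-next t = trans (cong prev (next≡⊕1 t)) (//-rightDividesʳ ⟦ 1 ⟧ t)

  ⊝-⊝ : ∀ (t c : Fin (suc n)) → t ⊝ (t ⊝ c) ≡ c
  ⊝-⊝ t c = trans (cong (t ⊕_) (⁻¹-anti-homo-// t c)) (trans (⊕-comm t (c ⊝ t)) (//-rightDividesˡ t c))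

  ⊕-⊝ˡ : ∀ (a x : Fin (suc n)) → (a ⊕ x) ⊝ a ≡ x
  ⊕-⊝ˡ a x = trans (cong (_⊝ a) (⊕-comm a x)) (//-rightDividesʳ a x)

  ⊝-cancelˡ : ∀ (a d e : Fin (suc n)) → (a ⊕ d) ⊝ (a ⊕ e) ≡ d ⊝ e
  ⊝-cancelˡ a d e = ∙-cancelʳ (a ⊕ e) _ _ (begin
    ((a ⊕ d) ⊝ (a ⊕ e)) ⊕ (a ⊕ e)  ≡⟨ //-rightDividesˡ (a ⊕ e) (a ⊕ d) ⟩
    a ⊕ d                          ≡⟨ cong (a ⊕_) (//-rightDividesˡ e d) ⟨
    a ⊕ ((d ⊝ e) ⊕ e)              ≡⟨ ⊕-assoc a (d ⊝ e) e ⟨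
    (a ⊕ (d ⊝ e)) ⊕ e              ≡⟨ cong (_⊕ e) (⊕-comm a (d ⊝ e)) ⟩
    ((d ⊝ e) ⊕ a) ⊕ e              ≡⟨ ⊕-assoc (d ⊝ e) a e ⟩
    (d ⊝ e) ⊕ (a ⊕ e)              ∎)

  ⊝-chain : ∀ (x y w : Fin (suc n)) → (x ⊝ w) ⊕ (y ⊝ x) ≡ y ⊝ w
  ⊝-chain x y w = begin
    (x ⊝ w) ⊕ (y ⊝ x)     ≡⟨ ⊕-comm (x ⊝ w) (y ⊝ x) ⟩
    (y ⊝ x) ⊕ (x ⊝ w)     ≡⟨ ⊕-assoc (y ⊝ x) x (⊖ w) ⟨
    ((y ⊝ x) ⊕ x) ⊝ w     ≡⟨ cong (_⊝ w) (//-rightDividesˡ x y) ⟩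
    y ⊝ w                 ∎

  ⊝-⊕ : ∀ (x a w : Fin (suc n)) → x ⊝ (a ⊕ w) ≡ (x ⊝ w) ⊝ a
  ⊝-⊕ x a w = begin
    x ⊕ (⊖ (a ⊕ w))         ≡⟨ cong (λ z → x ⊕ (⊖ z)) (⊕-comm a w) ⟩
    x ⊕ (⊖ (w ⊕ a))         ≡⟨ cong (x ⊕_) (⁻¹-∙-comm w a) ⟨
    x ⊕ ((⊖ w) ⊕ (⊖ a))     ≡⟨ ⊕-assoc x (⊖ w) (⊖ a) ⟨
    (x ⊝ w) ⊝ a             ∎

  ⊕-⊝ : ∀ (a w x : Fin (suc n)) → (a ⊕ w) ⊝ x ≡ a ⊝ (x ⊝ w)
  ⊕-⊝ a w x = begin
    (a ⊕ w) ⊝ x             ≡⟨ ⊕-assoc a w (⊖ x) ⟩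
    a ⊕ (w ⊝ x)             ≡⟨ cong (a ⊕_) (⁻¹-anti-homo-// x w) ⟨
    a ⊝ (x ⊝ w)             ∎

  ⟦multiple⟧ : ∀ a → ⟦ a * suc n ⟧ ≡ fzero
  ⟦multiple⟧ a = trans (⟦⟧-≡-% (a * suc n) 0 (m*n%n≡0 a (suc n))) ⟦0⟧

  -- For p = n + 1 prime, every element of ℤ/pℤ is a multiple of any
  -- nonzero w: by Bézout, w is invertible modulo p.
  multiples-cover : Prime (suc n) → ∀ w → w ≢ fzero → ∀ d → ∃[ m ] ⟦ m * toℕ w ⟧ ≡ d
  multiples-cover p-prime w w≢0 d with coprime-Bézout (prime⇒coprime p-prime {{W≢0}} (toℕ<n w))
    where
    W≢0 : NonZero (toℕ w)
    W≢0 = ≢-nonZero (λ W≡0 → w≢0 (toℕ-injective W≡0))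
  ... | Bézout.-+ x y 1+xp≡yW = toℕ d * y , (begin
    ⟦ toℕ d * y * toℕ w ⟧                  ≡⟨ cong ⟦_⟧ (ℕ.*-assoc (toℕ d) y (toℕ w)) ⟩
    ⟦ toℕ d * (y * toℕ w) ⟧                ≡⟨ cong (λ z → ⟦ toℕ d * z ⟧) 1+xp≡yW ⟨
    ⟦ toℕ d * (1 + x * suc n) ⟧            ≡⟨ cong ⟦_⟧ (distribute (toℕ d) x) ⟩
    ⟦ toℕ d + toℕ d * x * suc n ⟧          ≡⟨ ⟦⟧-+ (toℕ d) (toℕ d * x * suc n) ⟨
    ⟦ toℕ d ⟧ ⊕ ⟦ toℕ d * x * suc n ⟧      ≡⟨ cong₂ _⊕_ (⟦toℕ⟧ d) (⟦multiple⟧ (toℕ d * x)) ⟩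
    d ⊕ fzero                              ≡⟨ ⊕-identityʳ d ⟩
    d                                      ∎)
    where
    distribute : ∀ a b → a * (1 + b * suc n) ≡ a + a * b * suc n
    distribute a b = trans (ℕ.*-distribˡ-+ a 1 (b * suc n))
                       (cong₂ _+_ (ℕ.*-identityʳ a) (sym (ℕ.*-assoc a b (suc n))))
  ... | Bézout.+- x y 1+yW≡xp = e * y , x∙y⁻¹≈ε⇒x≈y ⟦ e * y * toℕ w ⟧ d (begin
    ⟦ e * y * toℕ w ⟧ ⊕ ⟦ e ⟧              ≡⟨ ⟦⟧-+ (e * y * toℕ w) e ⟩
    ⟦ e * y * toℕ w + e ⟧                  ≡⟨ cong ⟦_⟧ (factor e y (toℕ w)) ⟩
    ⟦ e * (1 + y * toℕ w) ⟧                ≡⟨ cong (λ z → ⟦ e * z ⟧) 1+yW≡xp ⟩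
    ⟦ e * (x * suc n) ⟧                    ≡⟨ cong ⟦_⟧ (ℕ.*-assoc e x (suc n)) ⟨
    ⟦ e * x * suc n ⟧                      ≡⟨ ⟦multiple⟧ (e * x) ⟩
    fzero                                  ∎)
    where
    -- -d, so that ⟦ e ⟧ = ⊖ d by definition
    e : ℕ
    e = suc n ∸ toℕ d
    factor : ∀ a b c → a * b * c + a ≡ a * (1 + b * c)
    factor a b c = begin
      a * b * c + a              ≡⟨ cong₂ _+_ (ℕ.*-assoc a b c) (sym (ℕ.*-identityʳ a)) ⟩
      a * (b * c) + a * 1        ≡⟨ ℕ.*-distribˡ-+ a (b * c) 1 ⟨
      a * (b * c + 1)            ≡⟨ cong (a *_) (ℕ.+-comm (b * c) 1) ⟩
      a * (1 + b * c)            ∎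

sum-zero : ∀ {m} (f : Fin m → Bool) → (∀ x → f x ≡ false) → sum f ≡ false
sum-zero {m} f f≡0 = trans (sum-cong-≗ f≡0) (sum-replicate-zero m)

sum-single : ∀ {m} (f : Fin m → Bool) (u : Fin m) →
             (∀ x → x ≢ u → f x ≡ false) → sum f ≡ f u
sum-single {suc m} f u off-u = begin
  sum f                               ≡⟨ sum-remove {i = u} f ⟩
  f u xor sum (f ∘ punchIn u)         ≡⟨ cong (f u xor_) (sum-zero _ λ x → off-u _ (punchInᵢ≢i u x)) ⟩
  f u xor false                       ≡⟨ xor-identityʳ (f u) ⟩
  f u                                 ∎
  where open ≡-Reasoning

sum-true : ∀ {m} (f : Fin m → Bool) → sum f ≡ true → ∃[ x ] f x ≡ true
sum-true {zero}  f ()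
sum-true {suc m} f s with f fzero in eq
... | true  = fzero , eq
... | false with sum-true (f ∘ fsuc) s
...   | x , fx = fsuc x , fx

sum-reindex : ∀ {m} (f : Fin m → Bool) (g h : Fin m → Fin m) →
              (∀ x → g (h x) ≡ x) → (∀ x → h (g x) ≡ x) → sum f ≡ sum (f ∘ g)
sum-reindex f g h gh hg = sum-permute f (permutation g h gh hg)

·-as-sum : ∀ {p} (v x : BV p) → v · x ≡ sum (λ i → v i ∧ x i)
·-as-sum v x = trans (cong (foldr _xor_ false) (map-tabulate id (λ i → v i ∧ x i)))
                         (foldr-tabulate (λ i → v i ∧ x i))
  where
  foldr-tabulate : ∀ {m} (f : Fin m → Bool) → foldr _xor_ false (tabulate f) ≡ sum f
  foldr-tabulate {zero}  f = refl
  foldr-tabulate {suc m} f = cong (f fzero xor_) (foldr-tabulate (f ∘ fsuc))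

count : ∀ {m} → (Fin m → Bool) → ℕ
count {m} f = length (filter (λ t → Bool._≟_ (f t) true) (allFin m))

odd : ℕ → Bool
odd zero    = false
odd (suc k) = not (odd k)

sum≡odd-count : ∀ {m} (f : Fin m → Bool) → sum f ≡ odd (count f)
sum≡odd-count f = count-tabulate f id
  where
  count-tabulate : ∀ {m A} (h : A → Bool) (g : Fin m → A) →
       sum (h ∘ g) ≡ odd (length (filter (λ a → Bool._≟_ (h a) true) (tabulate g)))
  count-tabulate {zero}  h g = refl
  count-tabulate {suc m} h g with h (g fzero)
  ... | true  = cong not (count-tabulate h (g ∘ fsuc))
  ... | false = count-tabulate h (g ∘ fsuc)

count-zero : ∀ {m} (f : Fin m → Bool) → count f ≡ 0 → ∀ t → f t ≡ false
count-zero {m} f c≡0 t with f t in eq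
... | false = refl
... | true  = ⊥-elim (ℕ.<-irrefl (sym c≡0)
                (filter-some (λ t → Bool._≟_ (f t) true) (lose (∈-allFin t) eq)))

-- m is even, expressed in 𝔽₂ as m · 1 = 0
IsEven : ℕ → Set
IsEven m = sum {m} (λ _ → true) ≡ false

true≢false : true ≢ false
true≢false ()

sum-point : ∀ {m} (u : Fin m) (h : Fin m → Bool) → sum (λ c → does (c ≟ u) ∧ h c) ≡ h u
sum-point u h = trans (sum-single _ u (λ c c≢u → cong (_∧ h c) (dec-false (c ≟ u) c≢u)))
                      (cong (_∧ h u) (dec-true (u ≟ u) refl))

-- The 𝔽₂-indicator of the image of D, computed as the parity of the
-- number of preimages (for injective D it is the usual indicator).
image : ∀ {k m} → (Fin k → Fin m) → Fin m → Bool
image D c = sum (λ t → does (c ≟ D t))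

sum-image : ∀ {k m} (D : Fin k → Fin m) (h : Fin m → Bool) →
            sum (λ c → image D c ∧ h c) ≡ sum (h ∘ D)
sum-image D h = begin
  sum (λ c → image D c ∧ h c)                      ≡⟨ sum-cong-≗ (λ c → *-distribʳ-sum (h c) (λ t → does (c ≟ D t))) ⟩
  sum (λ c → sum (λ t → does (c ≟ D t) ∧ h c))    ≡⟨ ∑-comm (λ c t → does (c ≟ D t) ∧ h c) ⟩
  sum (λ t → sum (λ c → does (c ≟ D t) ∧ h c))    ≡⟨ sum-cong-≗ (λ t → sum-point (D t) h) ⟩
  sum (h ∘ D)                                      ∎
  where open ≡-Reasoning

image-true : ∀ {k m} (D : Fin k → Fin m) c → image D c ≡ true → ∃[ t ] D t ≡ c
image-true D c e with sum-true _ e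
... | t , eq with c ≟ D t
...   | yes c≡Dt = t , sym c≡Dt
...   | no  _    = ⊥-elim (false≢true eq)
  where
  false≢true : false ≢ true
  false≢true ()

module WorkingTogether (n : ℕ) (v : BV (suc n)) (wt : WorkTogether v ē) where
  open ZMod n
  open ≡-Reasoning

  σ^-translate : ∀ m (x : BV (suc n)) j → σ^ m x j ≡ x (j ⊝ ⟦ m ⟧)
  σ^-translate zero    x j = cong x (sym (begin
    j ⊝ ⟦ 0 ⟧     ≡⟨ cong (λ z → j ⊝ z) ⟦0⟧ ⟩
    j ⊕ (⊖ fzero) ≡⟨ cong (j ⊕_) ε⁻¹≈ε ⟩
    j ⊕ fzero     ≡⟨ ⊕-identityʳ j ⟩
    j             ∎))
  σ^-translate (suc m) x j = trans (σ^-translate m x (j ⊝ ⟦ 1 ⟧)) (cong x (begin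
    (j ⊝ ⟦ 1 ⟧) ⊝ ⟦ m ⟧             ≡⟨ ⊕-assoc j (⊖ ⟦ 1 ⟧) (⊖ ⟦ m ⟧) ⟩
    j ⊕ ((⊖ ⟦ 1 ⟧) ⊕ (⊖ ⟦ m ⟧))     ≡⟨ cong (j ⊕_) (⁻¹-∙-comm ⟦ 1 ⟧ ⟦ m ⟧) ⟩
    j ⊝ (⟦ 1 ⟧ ⊕ ⟦ m ⟧)             ≡⟨ cong (j ⊝_) (⟦⟧-+ 1 m) ⟩
    j ⊝ ⟦ suc m ⟧                   ∎))

  sum-ē : ∀ (y : BV (suc n)) → sum (λ i → ē i ∧ y i) ≡ sum y xor y fzero
  sum-ē y = cancel (y fzero) (sum (y ∘ fsuc))
    where
    cancel : ∀ a s → s ≡ (a xor s) xor a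
    cancel false s = sym (xor-identityʳ s)
    cancel true  false = refl
    cancel true  true  = refl

  translate-orthogonal : ∀ x → ∃[ t ] (sum (λ i → v i ∧ x (i ⊝ t)) ≡ false
                                    × sum (λ i → ē i ∧ x (i ⊝ t)) ≡ false)
  translate-orthogonal x with wt x
  ... | m , v⊥ , ē⊥ = ⟦ m ⟧ , orthogonal v v⊥ , orthogonal ē ē⊥
    where
    orthogonal : ∀ w → w · σ^ m x ≡ false → sum (λ i → w i ∧ x (i ⊝ ⟦ m ⟧)) ≡ false
    orthogonal w w⊥ = trans (sum-cong-≗ λ i → cong (w i ∧_) (sym (σ^-translate m x i)))
                            (trans (sym (·-as-sum w (σ^ m x))) w⊥)

  xor≡0 : ∀ {a b} → a xor b ≡ false → a ≡ true → b ≡ true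
  xor≡0 {b = true}  _ _    = refl
  xor≡0 {b = false} e refl = sym e

  odd-set-out : ∀ (X : BV (suc n)) → sum X ≡ true →
                ∃[ u ] (X u ≡ true × sum (λ c → X c ∧ v (c ⊝ u)) ≡ false)
  odd-set-out X odd with translate-orthogonal X
  ... | t , v⊥ , ē⊥ = ⊖ t , xor≡0 (trans (sym size) ē⊥) odd , trans neighbours v⊥
    where
    shift-back : ∀ i → (i ⊝ t) ⊝ (⊖ t) ≡ i
    shift-back i = trans (cong ((i ⊝ t) ⊕_) (⁻¹-involutive t)) (//-rightDividesˡ t i)
    size : sum (λ i → ē i ∧ X (i ⊝ t)) ≡ sum X xor X (⊖ t)
    size = begin
      sum (λ i → ē i ∧ X (i ⊝ t))           ≡⟨ sum-ē (λ i → X (i ⊝ t)) ⟩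
      sum (λ i → X (i ⊝ t)) xor X (fzero ⊝ t) ≡⟨ cong₂ _xor_ (sym (sum-reindex X (_⊝ t) (_⊕ t) (//-rightDividesʳ t) (//-rightDividesˡ t)))
                                                              (cong X (⊕-identityˡ (⊖ t))) ⟩
      sum X xor X (⊖ t)                     ∎
    neighbours : sum (λ c → X c ∧ v (c ⊝ (⊖ t))) ≡ sum (λ i → v i ∧ X (i ⊝ t))
    neighbours = begin
      sum (λ c → X c ∧ v (c ⊝ (⊖ t)))                 ≡⟨ sum-reindex (λ c → X c ∧ v (c ⊝ (⊖ t))) (_⊝ t) (_⊕ t) (//-rightDividesʳ t) (//-rightDividesˡ t) ⟩
      sum (λ i → X (i ⊝ t) ∧ v ((i ⊝ t) ⊝ (⊖ t)))     ≡⟨ sum-cong-≗ (λ i → trans (∧-comm (X (i ⊝ t)) _) (cong (λ z → v z ∧ X (i ⊝ t)) (shift-back i))) ⟩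
      sum (λ i → v i ∧ X (i ⊝ t))                     ∎

  odd-set-in : ∀ (X : BV (suc n)) → sum X ≡ true →
               ∃[ u ] (X u ≡ true × sum (λ c → X c ∧ v (u ⊝ c)) ≡ false)
  odd-set-in X odd with translate-orthogonal (X ∘ ⊖_)
  ... | t , v⊥ , ē⊥ = t , xor≡0 (trans (sym size) ē⊥) odd , trans neighbours v⊥
    where
    X-reflected : ∀ i → X (⊖ (i ⊝ t)) ≡ X (t ⊝ i)
    X-reflected i = cong X (⁻¹-anti-homo-// i t)
    size : sum (λ i → ē i ∧ X (⊖ (i ⊝ t))) ≡ sum X xor X t
    size = begin
      sum (λ i → ē i ∧ X (⊖ (i ⊝ t)))                   ≡⟨ sum-ē (λ i → X (⊖ (i ⊝ t))) ⟩
      sum (λ i → X (⊖ (i ⊝ t))) xor X (⊖ (fzero ⊝ t))   ≡⟨ cong₂ _xor_ (sum-cong-≗ X-reflected) (X-reflected fzero) ⟩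
      sum (λ i → X (t ⊝ i)) xor X (t ⊝ fzero)           ≡⟨ cong₂ _xor_ (sym (sum-reindex X (t ⊝_) (t ⊝_) (⊝-⊝ t) (⊝-⊝ t)))
                                                                       (cong (λ z → X (t ⊕ z)) ε⁻¹≈ε) ⟩
      sum X xor X (t ⊕ fzero)                           ≡⟨ cong (λ z → sum X xor X z) (⊕-identityʳ t) ⟩
      sum X xor X t                                     ∎
    neighbours : sum (λ c → X c ∧ v (t ⊝ c)) ≡ sum (λ i → v i ∧ X (⊖ (i ⊝ t)))
    neighbours = begin
      sum (λ c → X c ∧ v (t ⊝ c))                     ≡⟨ sum-reindex (λ c → X c ∧ v (t ⊝ c)) (t ⊝_) (t ⊝_) (⊝-⊝ t) (⊝-⊝ t) ⟩
      sum (λ i → X (t ⊝ i) ∧ v (t ⊝ (t ⊝ i)))         ≡⟨ sum-cong-≗ (λ i → trans (∧-comm (X (t ⊝ i)) _) (cong₂ _∧_ (cong v (⊝-⊝ t i)) (sym (X-reflected i)))) ⟩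
      sum (λ i → v i ∧ X (⊖ (i ⊝ t)))                 ∎

module Girth (n k : ℕ) (v : BV (suc n)) (v0 : v fzero ≡ false)
             (minimal : ∀ L (c : Fin L → Fin (suc n)) → IsDirCycle v L c → suc k ≤ L) where
  open ZMod n
  module Pos = ZMod k
  open ≡-Reasoning

  -- A chord of a shortest cycle is one of its arcs: an arc D j → D l forces
  -- l = j + 1, since otherwise the path D l → D (l+1) → … → D j, closed by
  -- the arc D j → D l, would be a cycle shorter than D.
  module Chord (D : Fin (suc k) → Fin (suc n)) (cyc : IsDirCycle v (suc k) D)
               (j l : Fin (suc k)) (chord : Arc v (D j) (D l)) where
    d : ℕ
    d = toℕ (j ⊝ l)

    path : Fin (suc d) → Fin (suc n)
    path s = D (l ⊕ Pos.⟦ toℕ s ⟧)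

    s<K : ∀ (s : Fin (suc d)) → toℕ s < suc k
    s<K s = ℕ.<-≤-trans (toℕ<n s) (toℕ<n (j ⊝ l))

    path-injective : ∀ {s s'} → path s ≡ path s' → s ≡ s'
    path-injective {s} {s'} e = toℕ-injective (begin
      toℕ s                   ≡⟨ Pos.toℕ-⟦⟧-< (s<K s) ⟨
      toℕ (Pos.⟦ toℕ s ⟧)     ≡⟨ cong toℕ (Pos.∙-cancelˡ l _ _ (proj₁ (proj₂ cyc) e)) ⟩
      toℕ (Pos.⟦ toℕ s' ⟧)    ≡⟨ Pos.toℕ-⟦⟧-< (s<K s') ⟩
      toℕ s'                  ∎)

    -- inner steps of the path are arcs of the cycle; the last step is the chord
    path-arc : ∀ s → Arc v (path s) (path (next s))
    path-arc s with ℕ.m≤n⇒m<n∨m≡n (toℕ<n s)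
    ... | inj₁ s+1<d+1 = subst (λ t → Arc v (path s) (D t)) step (proj₂ (proj₂ cyc) (l ⊕ Pos.⟦ toℕ s ⟧))
      where
      step : next (l ⊕ Pos.⟦ toℕ s ⟧) ≡ l ⊕ Pos.⟦ toℕ (next s) ⟧
      step = begin
        next (l ⊕ Pos.⟦ toℕ s ⟧)      ≡⟨ Pos.next-⊕ l _ ⟩
        l ⊕ next Pos.⟦ toℕ s ⟧        ≡⟨ cong (l ⊕_) (Pos.next-⟦⟧ (toℕ s)) ⟩
        l ⊕ Pos.⟦ suc (toℕ s) ⟧       ≡⟨ cong (λ m → l ⊕ Pos.⟦ m ⟧) (ZMod.toℕ-⟦⟧-< d s+1<d+1) ⟨
        l ⊕ Pos.⟦ toℕ (next s) ⟧      ∎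
    ... | inj₂ s+1≡d+1 = subst₂ (λ a b → Arc v (D a) (D b)) (sym at-j) (sym at-l) chord
      where
      at-j : l ⊕ Pos.⟦ toℕ s ⟧ ≡ j
      at-j = begin
        l ⊕ Pos.⟦ toℕ s ⟧   ≡⟨ cong (λ m → l ⊕ Pos.⟦ m ⟧) (ℕ.suc-injective s+1≡d+1) ⟩
        l ⊕ Pos.⟦ d ⟧       ≡⟨ cong (l ⊕_) (Pos.⟦toℕ⟧ (j ⊝ l)) ⟩
        l ⊕ (j ⊝ l)         ≡⟨ Pos.⊕-comm l _ ⟩
        (j ⊝ l) ⊕ l         ≡⟨ Pos.//-rightDividesˡ l j ⟩
        j                   ∎
      at-l : l ⊕ Pos.⟦ toℕ (next s) ⟧ ≡ l
      at-l = begin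
        l ⊕ Pos.⟦ toℕ (next s) ⟧  ≡⟨ cong (λ t → l ⊕ Pos.⟦ toℕ t ⟧) (ZMod.next-last d s (ℕ.suc-injective s+1≡d+1)) ⟩
        l ⊕ Pos.⟦ 0 ⟧             ≡⟨ cong (l ⊕_) Pos.⟦0⟧ ⟩
        l ⊕ fzero                 ≡⟨ Pos.⊕-identityʳ l ⟩
        l                         ∎

    path-cycle : IsDirCycle v (suc d) path
    path-cycle = (λ ()) , path-injective , path-arc

    d≡k : d ≡ k
    d≡k = ℕ.≤-antisym (ℕ.≤-pred (toℕ<n (j ⊝ l))) (ℕ.≤-pred (minimal (suc d) path path-cycle))

    chord-is-arc : l ≡ next j
    chord-is-arc = sym (begin
      next j                  ≡⟨ cong next (trans (Pos.⊕-comm l _) (Pos.//-rightDividesˡ l j)) ⟨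
      next (l ⊕ (j ⊝ l))      ≡⟨ Pos.next-⊕ l (j ⊝ l) ⟩
      l ⊕ next (j ⊝ l)        ≡⟨ cong (l ⊕_) (Pos.next-last (j ⊝ l) d≡k) ⟩
      l ⊕ fzero               ≡⟨ Pos.⊕-identityʳ l ⟩
      l                       ∎)

  open Chord using (chord-is-arc) public

  no-loop : ∀ a → v (a ⊝ a) ≡ false
  no-loop a = trans (cong v (⊖-inverseʳ a)) v0

  out-degree : ∀ D → IsDirCycle v (suc k) D → ∀ j → sum (λ t → v (D t ⊝ D j)) ≡ true
  out-degree D cyc j = trans (sum-single _ (next j) only-next) (proj₂ (proj₂ cyc) j)
    where
    only-next : ∀ t → t ≢ next j → v (D t ⊝ D j) ≡ false
    only-next t t≢next = ¬-not (t≢next ∘ chord-is-arc D cyc j t)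

  in-degree : ∀ D → IsDirCycle v (suc k) D → ∀ j → sum (λ t → v (D j ⊝ D t)) ≡ true
  in-degree D cyc j = trans (sum-single _ (Pos.prev j) only-prev)
                            (subst (λ i → Arc v (D (Pos.prev j)) (D i)) (Pos.next-prev j)
                                   (proj₂ (proj₂ cyc) (Pos.prev j)))
    where
    only-prev : ∀ t → t ≢ Pos.prev j → v (D j ⊝ D t) ≡ false
    only-prev t t≢prev = ¬-not λ arc →
      t≢prev (trans (sym (Pos.prev-next t)) (cong Pos.prev (sym (chord-is-arc D cyc t j arc))))

  module _ (wt : WorkTogether v ē) where
    open WorkingTogether n v wt

    -- A shortest cycle has even length: otherwise its vertex set is odd, and
    -- the parity lemma yields a vertex of it with an even number of
    -- out-neighbours on it, while every vertex has exactly one.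
    even-length : ∀ D → IsDirCycle v (suc k) D → IsEven (suc k)
    even-length D cyc = ¬-not odd-length
      where
      size : sum (image D) ≡ sum {suc k} (λ _ → true)
      size = trans (sum-cong-≗ (λ c → sym (∧-identityʳ (image D c)))) (sum-image D (λ _ → true))

      odd-out-degree : ∀ j → sum (λ c → image D c ∧ v (c ⊝ D j)) ≢ false
      odd-out-degree j even = true≢false (begin
        true                                   ≡⟨ out-degree D cyc j ⟨
        sum (λ t → v (D t ⊝ D j))              ≡⟨ sum-image D (λ c → v (c ⊝ D j)) ⟨
        sum (λ c → image D c ∧ v (c ⊝ D j))    ≡⟨ even ⟩
        false                                  ∎)

      no-even-vertex : ∃[ u ] (image D u ≡ true × sum (λ c → image D c ∧ v (c ⊝ u)) ≡ false) → ⊥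
      no-even-vertex (u , u∈D , even) with image-true D u u∈D
      ... | j , refl = odd-out-degree j even

      odd-length : sum {suc k} (λ _ → true) ≢ true
      odd-length odd = no-even-vertex (odd-set-out (image D) (trans size odd))

    -- A vertex a together with a shortest cycle D: the set D ∪ {a}, counted
    -- in 𝔽₂, has odd size.
    module WithVertex (D : Fin (suc k) → Fin (suc n)) (cyc : IsDirCycle v (suc k) D)
                      (a : Fin (suc n)) where
      X : BV (suc n)
      X c = image D c xor does (c ≟ a)

      sum-X : ∀ h → sum (λ c → X c ∧ h c) ≡ sum (h ∘ D) xor h a
      sum-X h = begin
        sum (λ c → X c ∧ h c)                                            ≡⟨ sum-cong-≗ (λ c → ∧-distribʳ-xor (h c) (image D c) (does (c ≟ a))) ⟩
        sum (λ c → (image D c ∧ h c) xor (does (c ≟ a) ∧ h c))          ≡⟨ ∑-distrib-+ (λ c → image D c ∧ h c) (λ c → does (c ≟ a) ∧ h c) ⟩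
        sum (λ c → image D c ∧ h c) xor sum (λ c → does (c ≟ a) ∧ h c)  ≡⟨ cong₂ _xor_ (sum-image D h) (sum-point a h) ⟩
        sum (h ∘ D) xor h a                                              ∎

      X-odd : sum X ≡ true
      X-odd = begin
        sum X                                  ≡⟨ sum-cong-≗ (λ c → sym (∧-identityʳ (X c))) ⟩
        sum (λ c → X c ∧ true)                 ≡⟨ sum-X (λ _ → true) ⟩
        sum {suc k} (λ _ → true) xor true      ≡⟨ cong (_xor true) (even-length D cyc) ⟩
        true                                   ∎

      X-member : ∀ u → X u ≡ true → u ≡ a ⊎ ∃[ j ] D j ≡ u
      X-member u Xu with u ≟ a
      ... | yes u≡a = inj₁ u≡a
      ... | no  _   = inj₂ (image-true D u (trans (sym (xor-identityʳ (image D u))) Xu))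

      no-single-out-edge : sum (λ t → v (D t ⊝ a)) ≡ true → (∀ t → v (a ⊝ D t) ≡ false) → ⊥
      no-single-out-edge odd none = no-even-vertex (odd-set-out X X-odd)
        where
        odd-out : ∀ {u} → u ≡ a ⊎ ∃[ j ] D j ≡ u → sum (λ t → v (D t ⊝ u)) ≡ true
        odd-out (inj₁ refl)       = odd
        odd-out (inj₂ (j , refl)) = out-degree D cyc j
        no-in : ∀ {u} → u ≡ a ⊎ ∃[ j ] D j ≡ u → v (a ⊝ u) ≡ false
        no-in (inj₁ refl)       = no-loop a
        no-in (inj₂ (j , refl)) = none j
        no-even-vertex : ∃[ u ] (X u ≡ true × sum (λ c → X c ∧ v (c ⊝ u)) ≡ false) → ⊥
        no-even-vertex (u , Xu , even) = true≢false (begin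
          true                                   ≡⟨ cong₂ _xor_ (odd-out (X-member u Xu)) (no-in (X-member u Xu)) ⟨
          sum (λ t → v (D t ⊝ u)) xor v (a ⊝ u)  ≡⟨ sum-X (λ c → v (c ⊝ u)) ⟨
          sum (λ c → X c ∧ v (c ⊝ u))            ≡⟨ even ⟩
          false                                  ∎)

      no-single-in-edge : sum (λ t → v (a ⊝ D t)) ≡ true → (∀ t → v (D t ⊝ a) ≡ false) → ⊥
      no-single-in-edge odd none = no-even-vertex (odd-set-in X X-odd)
        where
        odd-in : ∀ {u} → u ≡ a ⊎ ∃[ j ] D j ≡ u → sum (λ t → v (u ⊝ D t)) ≡ true
        odd-in (inj₁ refl)       = odd
        odd-in (inj₂ (j , refl)) = in-degree D cyc j
        no-out : ∀ {u} → u ≡ a ⊎ ∃[ j ] D j ≡ u → v (u ⊝ a) ≡ false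
        no-out (inj₁ refl)       = no-loop a
        no-out (inj₂ (j , refl)) = none j
        no-even-vertex : ∃[ u ] (X u ≡ true × sum (λ c → X c ∧ v (u ⊝ c)) ≡ false) → ⊥
        no-even-vertex (u , Xu , even) = true≢false (begin
          true                                   ≡⟨ cong₂ _xor_ (odd-in (X-member u Xu)) (no-out (X-member u Xu)) ⟨
          sum (λ t → v (u ⊝ D t)) xor v (u ⊝ a)  ≡⟨ sum-X (λ c → v (u ⊝ c)) ⟨
          sum (λ c → X c ∧ v (u ⊝ c))            ≡⟨ even ⟩
          false                                  ∎)

    open WithVertex using (no-single-out-edge; no-single-in-edge) public

  Isolated : ∀ {L} → Fin (suc n) → (Fin L → Fin (suc n)) → Set
  Isolated a D = (∀ t → v (D t ⊝ a) ≡ false) × (∀ t → v (a ⊝ D t) ≡ false)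

  -- Swapping two consecutive steps of a shortest cycle: replacing the
  -- vertex D (r+1) by b = D r + (D (r+2) - D (r+1)) gives again a shortest
  -- cycle E, and a vertex isolated from D stays isolated from E.
  module Swap (D : Fin (suc k) → Fin (suc n)) (r : Fin (suc k)) where
    r₁ r₂ : Fin (suc k)
    r₁ = next r
    r₂ = next r₁

    b : Fin (suc n)
    b = D r ⊕ (D r₂ ⊝ D r₁)

    Swapped : (Fin (suc k) → Fin (suc n)) → Set
    Swapped E = E r₁ ≡ b × (∀ t → t ≢ r₁ → E t ≡ D t)

    module _ (cyc : IsDirCycle v (suc k) D) where
      arc-into-b : Arc v (D r) b
      arc-into-b = trans (cong v (⊕-⊝ˡ (D r) _)) (proj₂ (proj₂ cyc) r₁)

      arc-from-b : Arc v b (D r₂)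
      arc-from-b = trans (cong v b-step) (proj₂ (proj₂ cyc) r)
        where
        b-step : D r₂ ⊝ b ≡ D r₁ ⊝ D r
        b-step = begin
          D r₂ ⊝ b                                         ≡⟨ cong (_⊝ b) (//-rightDividesˡ (D r₁) (D r₂)) ⟨
          ((D r₂ ⊝ D r₁) ⊕ D r₁) ⊝ (D r ⊕ (D r₂ ⊝ D r₁))   ≡⟨ cong (((D r₂ ⊝ D r₁) ⊕ D r₁) ⊝_) (⊕-comm (D r) _) ⟩
          ((D r₂ ⊝ D r₁) ⊕ D r₁) ⊝ ((D r₂ ⊝ D r₁) ⊕ D r)   ≡⟨ ⊝-cancelˡ (D r₂ ⊝ D r₁) (D r₁) (D r) ⟩
          D r₁ ⊝ D r                                       ∎

      -- b is not a vertex of D other than D r₁: an arc D r → D t is the arc D r → D r₁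
      b-new : ∀ t → t ≢ r₁ → b ≢ D t
      b-new t t≢r₁ b≡Dt = t≢r₁ (chord-is-arc D cyc r t (subst (Arc v (D r)) b≡Dt arc-into-b))

      next-≢ : ∀ t → next t ≢ t
      next-≢ t e = true≢false (begin
        true                  ≡⟨ proj₂ (proj₂ cyc) t ⟨
        v (D (next t) ⊝ D t)  ≡⟨ cong (λ i → v (D i ⊝ D t)) e ⟩
        v (D t ⊝ D t)         ≡⟨ no-loop (D t) ⟩
        false                 ∎)

      module _ (E : Fin (suc k) → Fin (suc n)) (swapped : Swapped E) where
        E-cases : ∀ t → (t ≡ r₁ × E t ≡ b) ⊎ (t ≢ r₁ × E t ≡ D t)
        E-cases t with t ≟ r₁
        ... | yes refl    = inj₁ (refl , proj₁ swapped)
        ... | no  t≢r₁    = inj₂ (t≢r₁ , proj₂ swapped t t≢r₁)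

        E-injective : ∀ {t t'} → E t ≡ E t' → t ≡ t'
        E-injective {t} {t'} e with E-cases t | E-cases t'
        ... | inj₁ (refl , _)     | inj₁ (refl , _)     = refl
        ... | inj₁ (refl , Et≡b)  | inj₂ (t'≢r₁ , Et')  = ⊥-elim (b-new t' t'≢r₁ (trans (sym Et≡b) (trans e Et')))
        ... | inj₂ (t≢r₁ , Et)    | inj₁ (refl , Et'≡b) = ⊥-elim (b-new t t≢r₁ (trans (sym Et'≡b) (trans (sym e) Et)))
        ... | inj₂ (_ , Et)       | inj₂ (_ , Et')      = proj₁ (proj₂ cyc) (trans (sym Et) (trans e Et'))

        E-arc : ∀ t → Arc v (E t) (E (next t))
        E-arc t with E-cases t | E-cases (next t)
        ... | inj₁ (refl , Et≡b) | _ =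
          subst₂ (Arc v) (sym Et≡b) (sym (proj₂ swapped r₂ (next-≢ r₁))) arc-from-b
        ... | inj₂ (_ , Et) | inj₁ (t+1≡r₁ , Et+1≡b) =
          subst₂ (Arc v) (trans (cong D (sym t≡r)) (sym Et)) (sym Et+1≡b) arc-into-b
          where
          t≡r : t ≡ r
          t≡r = trans (sym (Pos.prev-next t)) (trans (cong Pos.prev t+1≡r₁) (Pos.prev-next r))
        ... | inj₂ (_ , Et) | inj₂ (_ , Et+1) = subst₂ (Arc v) (sym Et) (sym Et+1) (proj₂ (proj₂ cyc) t)

        E-cycle : IsDirCycle v (suc k) E
        E-cycle = proj₁ cyc , E-injective , E-arc

        on-E : ∀ (h : Fin (suc n) → Bool) → h b ≡ false → (∀ t → h (D t) ≡ false) → ∀ t → h (E t) ≡ false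
        on-E h hb hD t with E-cases t
        ... | inj₁ (_ , Et≡b) = trans (cong h Et≡b) hb
        ... | inj₂ (_ , Et)   = trans (cong h Et) (hD t)

        sum-over-E : ∀ (h : Fin (suc n) → Bool) → (∀ t → h (D t) ≡ false) → sum (h ∘ E) ≡ h b
        sum-over-E h hD = trans (sum-single (h ∘ E) r₁ (λ t t≢r₁ → trans (cong h (proj₂ swapped t t≢r₁)) (hD t)))
                                (cong h (proj₁ swapped))

        -- Isolation from D carries over to E: an arc a → b alone, or b → a
        -- alone, would be a single edge between a and the shortest cycle E,
        -- and both arcs together are excluded by smallness of v.
        isolated-swap : WorkTogether v ē → Small v → ∀ a → Isolated a D → Isolated a E
        isolated-swap wt small a (no-out , no-in) = on-E (λ c → v (c ⊝ a)) b-not-out no-out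
                                                  , on-E (λ c → v (a ⊝ c)) b-not-in no-in
          where
          not-both : v (b ⊝ a) ≡ true → v (a ⊝ b) ≡ false
          not-both a→b = ¬-not λ b→a → small (b ⊝ a , a→b , trans (cong v (⁻¹-anti-homo-// b a)) b→a)

          b-not-out : v (b ⊝ a) ≡ false
          b-not-out = ¬-not λ a→b →
            no-single-out-edge wt E E-cycle a (trans (sum-over-E (λ c → v (c ⊝ a)) no-out) a→b)
                                              (on-E (λ c → v (a ⊝ c)) (not-both a→b) no-in)

          b-not-in : v (a ⊝ b) ≡ false
          b-not-in = ¬-not λ b→a →
            no-single-in-edge wt E E-cycle a (trans (sum-over-E (λ c → v (a ⊝ c)) no-in) b→a)
                                             (on-E (λ c → v (c ⊝ a)) b-not-out no-out)

  cycle-≗ : ∀ {L} {D E : Fin L → Fin (suc n)} → (∀ j → D j ≡ E j) → IsDirCycle v L D → IsDirCycle v L E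
  cycle-≗ D≗E (L≢0 , inj , arc) =
    L≢0 , (λ e → inj (trans (D≗E _) (trans e (sym (D≗E _))))) , (λ t → subst₂ (Arc v) (D≗E t) (D≗E (next t)) (arc t))

  isolated-≗ : ∀ {L a} {D E : Fin L → Fin (suc n)} → (∀ j → D j ≡ E j) → Isolated a D → Isolated a E
  isolated-≗ {a = a} D≗E (no-out , no-in) =
    (λ t → trans (cong (λ c → v (c ⊝ a)) (sym (D≗E t))) (no-out t)) ,
    (λ t → trans (cong (λ c → v (a ⊝ c)) (sym (D≗E t))) (no-in t))

  -- Rotating the steps of a shortest cycle C: bubbling the first step
  -- w = C 1 - C 0 to the end by k successive swaps turns C into the cycle
  -- j ↦ C (j+1) - w, i.e. C translated by -w.  Hence a vertex isolated from
  -- C has its translate by w isolated from C as well.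
  module Rotation (wt : WorkTogether v ē) (small : Small v)
                  (C : Fin (suc k) → Fin (suc n)) (cyc : IsDirCycle v (suc k) C) where
    w : Fin (suc n)
    w = C (next fzero) ⊝ C fzero

    -- the cycle after r swaps: positions j ≤ r have been moved to C (j+1) - w
    shifted : ℕ → Fin (suc k) → Fin (suc n)
    shifted r j = if does (toℕ j ≤? r) then C (next j) ⊝ w else C j

    shifted-moved : ∀ r j → toℕ j ≤ r → shifted r j ≡ C (next j) ⊝ w
    shifted-moved r j j≤r = cong (if_then C (next j) ⊝ w else C j) (dec-true (toℕ j ≤? r) j≤r)

    shifted-unmoved : ∀ r j → r < toℕ j → shifted r j ≡ C j
    shifted-unmoved r j r<j = cong (if_then C (next j) ⊝ w else C j) (dec-false (toℕ j ≤? r) (ℕ.<⇒≱ r<j))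

    shifted-0 : ∀ r → shifted r fzero ≡ C fzero
    shifted-0 r = trans (shifted-moved r fzero z≤n) (⊝-⊝ (C (next fzero)) (C fzero))

    shift-step : ∀ r → suc r < suc k →
                 Swap.Swapped (shifted r) Pos.⟦ r ⟧ (shifted (suc r))
    shift-step r r+1<K = moved , same
      where
      open Swap (shifted r) Pos.⟦ r ⟧ using (r₁; r₂; b)
      r<K : r < suc k
      r<K = ℕ.<-trans (ℕ.n<1+n r) r+1<K
      toℕ-r₁ : toℕ r₁ ≡ suc r
      toℕ-r₁ = trans (cong toℕ (Pos.next-⟦⟧ r)) (Pos.toℕ-⟦⟧-< r+1<K)
      r₂-unmoved : shifted r r₂ ≡ C r₂
      r₂-unmoved with ℕ.m≤n⇒m<n∨m≡n r+1<K
      ... | inj₁ r+2<K = shifted-unmoved r r₂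
              (subst (r <_) (sym (trans (cong toℕ (trans (cong next (Pos.next-⟦⟧ r)) (Pos.next-⟦⟧ (suc r))))
                                        (Pos.toℕ-⟦⟧-< r+2<K)))
                     (ℕ.<-trans (ℕ.n<1+n r) (ℕ.n<1+n (suc r))))
      ... | inj₂ r+2≡K = trans (cong (shifted r) r₂≡0) (trans (shifted-0 r) (cong C (sym r₂≡0)))
        where
        r₂≡0 : r₂ ≡ fzero
        r₂≡0 = Pos.next-last r₁ (trans toℕ-r₁ (ℕ.suc-injective r+2≡K))
      moved : shifted (suc r) r₁ ≡ b
      moved = begin
        shifted (suc r) r₁                                   ≡⟨ shifted-moved (suc r) r₁ (ℕ.≤-reflexive toℕ-r₁) ⟩
        C r₂ ⊝ w                                             ≡⟨ ⊝-chain (C r₁) (C r₂) w ⟨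
        (C r₁ ⊝ w) ⊕ (C r₂ ⊝ C r₁)                           ≡⟨ cong₂ (λ x y → x ⊕ (y ⊝ C r₁)) (sym ρ-moved) (sym r₂-unmoved) ⟩
        shifted r Pos.⟦ r ⟧ ⊕ (shifted r r₂ ⊝ C r₁)          ≡⟨ cong (λ y → shifted r Pos.⟦ r ⟧ ⊕ (shifted r r₂ ⊝ y)) r₁-unmoved ⟨
        b                                                    ∎
        where
        ρ-moved : shifted r Pos.⟦ r ⟧ ≡ C r₁ ⊝ w
        ρ-moved = shifted-moved r Pos.⟦ r ⟧ (ℕ.≤-reflexive (Pos.toℕ-⟦⟧-< r<K))
        r₁-unmoved : shifted r r₁ ≡ C r₁
        r₁-unmoved = shifted-unmoved r r₁ (subst (r <_) (sym toℕ-r₁) (ℕ.n<1+n r))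
      same : ∀ t → t ≢ r₁ → shifted (suc r) t ≡ shifted r t
      same t t≢r₁ with ℕ.<-cmp (toℕ t) (suc r)
      ... | tri< t<r+1 _ _ = trans (shifted-moved (suc r) t (ℕ.<⇒≤ t<r+1)) (sym (shifted-moved r t (ℕ.≤-pred t<r+1)))
      ... | tri≈ _ t≡r+1 _ = ⊥-elim (t≢r₁ (toℕ-injective (trans t≡r+1 (sym toℕ-r₁))))
      ... | tri> _ _ r+1<t = trans (shifted-unmoved (suc r) t r+1<t) (sym (shifted-unmoved r t (ℕ.<-trans (ℕ.n<1+n r) r+1<t)))

    shifted-isolated : ∀ a → Isolated a C → ∀ r → r < suc k →
                       IsDirCycle v (suc k) (shifted r) × Isolated a (shifted r)
    shifted-isolated a iso zero _ = cycle-≗ C≗shifted₀ cyc , isolated-≗ {a = a} C≗shifted₀ iso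
      where
      C≗shifted₀ : ∀ j → C j ≡ shifted 0 j
      C≗shifted₀ fzero    = sym (shifted-0 0)
      C≗shifted₀ (fsuc j) = sym (shifted-unmoved 0 (fsuc j) (s≤s z≤n))
    shifted-isolated a iso (suc r) r+1<K with shifted-isolated a iso r (ℕ.<-trans (ℕ.n<1+n r) r+1<K)
    ... | cyc-r , iso-r = Swap.E-cycle (shifted r) Pos.⟦ r ⟧ cyc-r (shifted (suc r)) (shift-step r r+1<K)
                        , Swap.isolated-swap (shifted r) Pos.⟦ r ⟧ cyc-r (shifted (suc r)) (shift-step r r+1<K) wt small a iso-r

    isolated-+w : ∀ a → Isolated a C → Isolated (a ⊕ w) C
    isolated-+w a iso with shifted-isolated a iso k (ℕ.n<1+n k)
    ... | _ , (no-out , no-in) = no-out' , no-in'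
      where
      rotated : ∀ t → shifted k (Pos.prev t) ≡ C t ⊝ w
      rotated t = trans (shifted-moved k (Pos.prev t) (ℕ.≤-pred (toℕ<n (Pos.prev t))))
                        (cong (λ i → C i ⊝ w) (Pos.next-prev t))
      no-out' : ∀ t → v (C t ⊝ (a ⊕ w)) ≡ false
      no-out' t = trans (cong v (trans (⊝-⊕ (C t) a w) (cong (_⊝ a) (sym (rotated t))))) (no-out (Pos.prev t))
      no-in' : ∀ t → v ((a ⊕ w) ⊝ C t) ≡ false
      no-in' t = trans (cong v (trans (⊕-⊝ a w (C t)) (cong (a ⊝_) (sym (rotated t))))) (no-in (Pos.prev t))

    w≢0 : w ≢ fzero
    w≢0 w≡0 = true≢false (trans (sym (proj₂ (proj₂ cyc) fzero)) (trans (cong v w≡0) v0))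

    isolated-multiple : ∀ a → Isolated a C → ∀ m → Isolated (a ⊕ ⟦ m * toℕ w ⟧) C
    isolated-multiple a iso zero    = subst (λ x → Isolated x C) (sym (trans (cong (a ⊕_) ⟦0⟧) (⊕-identityʳ a))) iso
    isolated-multiple a iso (suc m) = subst (λ x → Isolated x C) add-w (isolated-+w (a ⊕ ⟦ m * toℕ w ⟧) (isolated-multiple a iso m))
      where
      add-w : (a ⊕ ⟦ m * toℕ w ⟧) ⊕ w ≡ a ⊕ ⟦ toℕ w + m * toℕ w ⟧
      add-w = begin
        (a ⊕ ⟦ m * toℕ w ⟧) ⊕ w              ≡⟨ ⊕-assoc a _ w ⟩
        a ⊕ (⟦ m * toℕ w ⟧ ⊕ w)              ≡⟨ cong (a ⊕_) (⊕-comm _ w) ⟩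
        a ⊕ (w ⊕ ⟦ m * toℕ w ⟧)              ≡⟨ cong (λ x → a ⊕ (x ⊕ ⟦ m * toℕ w ⟧)) (⟦toℕ⟧ w) ⟨
        a ⊕ (⟦ toℕ w ⟧ ⊕ ⟦ m * toℕ w ⟧)      ≡⟨ cong (a ⊕_) (⟦⟧-+ (toℕ w) (m * toℕ w)) ⟩
        a ⊕ ⟦ toℕ w + m * toℕ w ⟧            ∎

    -- For p prime no vertex is isolated from C: the isolated vertices are
    -- closed under adding multiples of w ≠ 0, i.e. under adding any element
    -- of ℤ/pℤ, while C 0 itself is not isolated from C.
    no-isolated-vertex : Prime (suc n) → ∀ a → ¬ Isolated a C
    no-isolated-vertex p-prime a iso = C₀-not-isolated (multiples-cover p-prime w w≢0 (C fzero ⊝ a))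
      where
      C₀-not-isolated : ∃[ m ] ⟦ m * toℕ w ⟧ ≡ C fzero ⊝ a → ⊥
      C₀-not-isolated (m , mw≡C₀-a) =
        true≢false (trans (sym (proj₂ (proj₂ cyc) fzero)) (proj₁ C₀-isolated (next fzero)))
        where
        reaches-C₀ : a ⊕ ⟦ m * toℕ w ⟧ ≡ C fzero
        reaches-C₀ = trans (cong (a ⊕_) mw≡C₀-a) (trans (⊕-comm a _) (//-rightDividesˡ a (C fzero)))
        C₀-isolated : Isolated (C fzero) C
        C₀-isolated = subst (λ x → Isolated x C) reaches-C₀ (isolated-multiple a iso m)

fewer-than-two : ∀ a b → a + b < 2 → (a ≡ 0 × b ≡ 0) ⊎ (a ≡ 1 × b ≡ 0) ⊎ (a ≡ 0 × b ≡ 1)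
fewer-than-two zero          zero          _ = inj₁ (refl , refl)
fewer-than-two (suc zero)    zero          _ = inj₂ (inj₁ (refl , refl))
fewer-than-two zero          (suc zero)    _ = inj₂ (inj₂ (refl , refl))
fewer-than-two zero          (suc (suc _)) (s≤s (s≤s ()))
fewer-than-two (suc zero)    (suc _)       (s≤s (s≤s ()))
fewer-than-two (suc (suc _)) _             (s≤s (s≤s ()))

-- Fewer than two edges between i and C would mean that i is
-- isolated from C or has a single edge to it; both are excluded above.
lemma4p6 : (p : ℕ) → Prime p → p ≢ 2 →
    (v : BV p) → Nonzero v → Small v → (∀ (z : Fin p) → toℕ z ≡ 0 → v z ≡ false) →
    WorkTogether v ē →
    (k : ℕ) → IsGirth v k →
    (C : Fin k → Fin p) → IsDirCycle v k C →
    (i : Fin p) → ¬ (i ∈C C) →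
    2 ≤ edgesBetween v i C
lemma4p6 zero    _       _ _ _ _     _    _  _       _             _ _   () _
lemma4p6 (suc n) _       _ _ _ _     _    _  zero    _             _ cyc _  _ = ⊥-elim (proj₁ cyc refl)
lemma4p6 (suc n) p-prime _ v _ small v₀≡0 wt (suc k) (_ , minimal) C cyc i _ = ℕ.≮⇒≥ excluded
  where
  open Girth n k v (v₀≡0 fzero refl) minimal
  open Rotation wt small C cyc using (no-isolated-vertex)

  out-arc in-arc : Fin (suc k) → Bool
  out-arc t = v (C t ⊝ i)
  in-arc  t = v (i ⊝ C t)

  excluded : count out-arc + count in-arc < 2 → ⊥
  excluded fewer with fewer-than-two (count out-arc) (count in-arc) fewer
  ... | inj₁ (none-out , none-in) =
    no-isolated-vertex p-prime i (count-zero out-arc none-out , count-zero in-arc none-in)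
  ... | inj₂ (inj₁ (one-out , none-in)) =
    no-single-out-edge wt C cyc i (trans (sum≡odd-count out-arc) (cong odd one-out)) (count-zero in-arc none-in)
  ... | inj₂ (inj₂ (none-out , one-in)) =
    no-single-in-edge wt C cyc i (trans (sum≡odd-count in-arc) (cong odd one-in)) (count-zero out-arc none-out)
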